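{- Let $p$ be an odd prime with $p \neq 5$, let $\alpha$ be a positive integer, and let $\beta$ and $\gamma$ be non-negative integers. Let $u, v \in \mathbb{Z}$ be coprime integers with $v$ even such that \[2^\alpha 5^{\beta} p^\gamma = v(v^4 - 10u^2v^2 + 5u^4).\] Then $v^4 - 10u^2v^2 + 5u^4 \neq 5$. -}

module Defs where

module Submission where

-- If Q := v⁴ − 10u²v² + 5u⁴ = 5 then 5v = N := 2^α 5^β p^γ, and the identity
-- 3125 (u² − v²)² = 4 (5v)⁴ + 625 Q gives 3125 w² = 4 N⁴ + 3125 in ℕ, where
-- w = |u² − v²|.
-- Then w = 2h + 1 is odd and 3125 h(h+1) = N⁴; as p ≠ 5 this forces β ≥ 2 and
-- h(h+1) = A·B·C with A = 2^(4α), B = 5^(4β−5), C = p^(4γ).  A prime divides at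
-- most one of h, h + 1, so h and h + 1 are complementary subproducts of A, B, C;
-- since A ≡ 0, B ≡ 13, C ≡ 1 (mod 16), only h = AB, h + 1 = C survives.  Finally
-- 2ᵃ 5^(3+4j) + 1 = p^(4γ) is impossible: modulo 3 if p ≠ 3, and for p = 3
-- because 81^γ ≡ 1 (mod 125) forces 25 ∣ γ, so 81^γ ≡ 1 (mod 11) and 11 would
-- divide 2ᵃ 5^(3+4j).

module Natural where

  open import Data.Bool.Base using (Bool; true; false; not)
  open import Data.Nat.Base
  open import Data.Nat.Properties
  open import Data.Nat.DivMod hiding (_mod_)
  open import Data.Nat.Divisibility
  open import Data.Nat.Primality
  open import Data.Nat.Tactic.RingSolver using (solve-∀)
  open import Data.Product.Base using (∃-syntax; _×_; _,_)
  open import Data.Sum.Base using (_⊎_; inj₁; inj₂)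
  open import Relation.Nullary using (¬_; ¬?; yes; no; contradiction)
  open import Relation.Nullary.Decidable using (from-yes; from-no; _→-dec_)
  open import Relation.Binary.PropositionalEquality

  -- Congruence modulo n: a and b leave the same remainder on division by n.
  -- It is a record (rather than an abbreviation) so that a and b can be
  -- inferred from it.

  infix 4 _≡_mod_
  record _≡_mod_ (a b n : ℕ) .{{_ : NonZero n}} : Set where
    constructor ≡-remainders
    field remainders : a % n ≡ b % n
  open _≡_mod_

  module _ {n : ℕ} .{{_ : NonZero n}} where

    ≡⇒≡mod : ∀ {a b} → a ≡ b → a ≡ b mod n
    ≡⇒≡mod a≡b = ≡-remainders (cong (_% n) a≡b)

    mod-refl : ∀ {a} → a ≡ a mod n
    mod-refl = ≡-remainders refl

    mod-sym : ∀ {a b} → a ≡ b mod n → b ≡ a mod n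
    mod-sym (≡-remainders a≡b) = ≡-remainders (sym a≡b)

    mod-trans : ∀ {a b c} → a ≡ b mod n → b ≡ c mod n → a ≡ c mod n
    mod-trans (≡-remainders a≡b) (≡-remainders b≡c) = ≡-remainders (trans a≡b b≡c)

    %-≡mod : ∀ a → a % n ≡ a mod n
    %-≡mod a = ≡-remainders (m%n%n≡m%n a n)

    suc-cong-mod : ∀ {a b} → a ≡ b mod n → suc a ≡ suc b mod n
    suc-cong-mod {a} {b} (≡-remainders a≡b) = ≡-remainders (begin
      (1 + a) % n              ≡⟨ %-distribˡ-+ 1 a n ⟩
      (1 % n + a % n) % n      ≡⟨ cong (λ r → (1 % n + r) % n) a≡b ⟩
      (1 % n + b % n) % n      ≡⟨ %-distribˡ-+ 1 b n ⟨
      (1 + b) % n              ∎)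
      where open ≡-Reasoning

    *-cong-mod : ∀ {a b c d} → a ≡ b mod n → c ≡ d mod n → a * c ≡ b * d mod n
    *-cong-mod {a} {b} {c} {d} (≡-remainders a≡b) (≡-remainders c≡d) = ≡-remainders (begin
      (a * c) % n              ≡⟨ %-distribˡ-* a c n ⟩
      (a % n * (c % n)) % n    ≡⟨ cong₂ (λ r s → (r * s) % n) a≡b c≡d ⟩
      (b % n * (d % n)) % n    ≡⟨ %-distribˡ-* b d n ⟨
      (b * d) % n              ∎)
      where open ≡-Reasoning

    ^-cong-mod : ∀ {a b} → a ≡ b mod n → ∀ k → a ^ k ≡ b ^ k mod n
    ^-cong-mod a≡b zero    = mod-refl
    ^-cong-mod a≡b (suc k) = *-cong-mod a≡b (^-cong-mod a≡b k)

    ∣-cong-mod : ∀ {a b} d .{{_ : NonZero d}} → d ∣ n → a ≡ b mod n → a ≡ b mod d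
    ∣-cong-mod {a} {b} d d∣n (≡-remainders a≡b) = ≡-remainders (begin
      a % d        ≡⟨ m∣n⇒o%n%m≡o%m d n a d∣n ⟨
      a % n % d    ≡⟨ cong (_% d) a≡b ⟩
      b % n % d    ≡⟨ m∣n⇒o%n%m≡o%m d n b d∣n ⟩
      b % d        ∎)
      where open ≡-Reasoning

    ^-period : ∀ {b} p .{{_ : NonZero p}} → b ^ p ≡ 1 mod n → ∀ k → b ^ k ≡ b ^ (k % p) mod n
    ^-period {b} p bᵖ≡1 k =
      mod-trans (≡⇒≡mod split-exponent)
                (mod-trans (*-cong-mod (mod-refl {b ^ (k % p)}) (^-cong-mod bᵖ≡1 q))
                           (≡⇒≡mod (trans (cong (b ^ (k % p) *_) (^-zeroˡ q)) (*-identityʳ _))))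
      where
      open ≡-Reasoning
      q = k / p
      split-exponent : b ^ k ≡ b ^ (k % p) * (b ^ p) ^ q
      split-exponent = begin
        b ^ k                       ≡⟨ cong (b ^_) (m≡m%n+[m/n]*n k p) ⟩
        b ^ (k % p + q * p)         ≡⟨ ^-distribˡ-+-* b (k % p) (q * p) ⟩
        b ^ (k % p) * b ^ (q * p)   ≡⟨ cong (λ e → b ^ (k % p) * b ^ e) (*-comm q p) ⟩
        b ^ (k % p) * b ^ (p * q)   ≡⟨ cong (b ^ (k % p) *_) (^-*-assoc b p q) ⟨
        b ^ (k % p) * (b ^ p) ^ q   ∎

  suc≡⇒∣ : ∀ {X m} n .{{_ : NonZero n}} → suc X ≡ m → m % n ≡ 1 → n ∣ X
  suc≡⇒∣ {X} {m} n X+1≡m m%n≡1 = divides (m / n) (suc-injective (begin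
    suc X                  ≡⟨ X+1≡m ⟩
    m                      ≡⟨ m≡m%n+[m/n]*n m n ⟩
    m % n + m / n * n      ≡⟨ cong (_+ m / n * n) m%n≡1 ⟩
    suc (m / n * n)        ∎))
    where open ≡-Reasoning

  ^-distribʳ-* : ∀ x y k → (x * y) ^ k ≡ x ^ k * y ^ k
  ^-distribʳ-* x y zero    = refl
  ^-distribʳ-* x y (suc k) = trans (cong (x * y *_) (^-distribʳ-* x y k))
                                   ([m*n]*[o*p]≡[m*o]*[n*p] x y (x ^ k) (y ^ k))

  odd⁴≡1[16] : ∀ q → q ≡ 1 mod 2 → q ^ 4 ≡ 1 mod 16
  odd⁴≡1[16] q q-odd =
    mod-trans (^-cong-mod (mod-sym (%-≡mod q)) 4)
              (≡-remainders (table (m%n<n q 16) (remainders q%16-odd)))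
    where
    q%16-odd : q % 16 ≡ 1 mod 2
    q%16-odd = mod-trans (∣-cong-mod 2 (divides 8 refl) (%-≡mod q)) q-odd
    table : ∀ {r} → r < 16 → r % 2 ≡ 1 → r ^ 4 % 16 ≡ 1
    table = from-yes (allUpTo? (λ r → (r % 2 ≟ 1) →-dec (r ^ 4 % 16 ≟ 1)) 16)

  fourth-power[3] : ∀ q → ¬ 3 ∣ q → q ^ 4 ≡ 1 mod 3
  fourth-power[3] q 3∤q =
    mod-trans (^-cong-mod (mod-sym (%-≡mod q)) 4)
              (≡-remainders (table (m%n<n q 3) (λ q%3≡0 → 3∤q (m%n≡0⇒n∣m q 3 q%3≡0))))
    where
    table : ∀ {r} → r < 3 → r ≢ 0 → r ^ 4 % 3 ≡ 1
    table = from-yes (allUpTo? (λ r → ¬? (r ≟ 0) →-dec (r ^ 4 % 3 ≟ 1)) 3)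

  prime[3] : Prime 3
  prime[3] = from-yes (prime? 3)

  prime[5] : Prime 5
  prime[5] = from-yes (prime? 5)

  prime[11] : Prime 11
  prime[11] = from-yes (prime? 11)

  prime∣^⇒∣ : ∀ {r} m k → Prime r → r ∣ m ^ k → r ∣ m
  prime∣^⇒∣ m zero    pr r∣1 = contradiction (subst Prime (∣1⇒≡1 r∣1) pr) ¬prime[1]
  prime∣^⇒∣ m (suc k) pr r∣m*mᵏ with euclidsLemma m (m ^ k) pr r∣m*mᵏ
  ... | inj₁ r∣m  = r∣m
  ... | inj₂ r∣mᵏ = prime∣^⇒∣ m k pr r∣mᵏ

  prime∣prime⇒≡ : ∀ {r s} → Prime r → Prime s → r ∣ s → r ≡ s
  prime∣prime⇒≡ pr ps r∣s with prime⇒irreducible ps r∣s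
  ... | inj₁ refl = contradiction pr ¬prime[1]
  ... | inj₂ r≡s  = r≡s

  ∤-powers : ∀ {r s t} → Prime r → ¬ r ∣ s → ¬ r ∣ t → ∀ a b → ¬ r ∣ s ^ a * t ^ b
  ∤-powers {s = s} {t} pr r∤s r∤t a b r∣ with euclidsLemma (s ^ a) (t ^ b) pr r∣
  ... | inj₁ r∣sᵃ = r∤s (prime∣^⇒∣ s a pr r∣sᵃ)
  ... | inj₂ r∣tᵇ = r∤t (prime∣^⇒∣ t b pr r∣tᵇ)

  ∤-consecutive : ∀ {r h} → Prime r → r ∣ h → ¬ r ∣ suc h
  ∤-consecutive {r} {h} pr r∣h r∣h+1 =
    ¬prime[1] (subst Prime (∣1⇒≡1 (∣m+n∣m⇒∣n (subst (r ∣_) (+-comm 1 h) r∣h+1) r∣h)) pr)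

  prime^∣*⇒∣ : ∀ {r y} → Prime r → ¬ r ∣ y → ∀ k x → r ^ k ∣ x * y → r ^ k ∣ x
  prime^∣*⇒∣ pr r∤y zero    x _ = 1∣ x
  prime^∣*⇒∣ {r} {y} pr r∤y (suc k) x rʳᵏ∣xy
    with euclidsLemma x y pr (∣-trans (m∣m*n (r ^ k)) rʳᵏ∣xy)
  ... | inj₂ r∣y = contradiction r∣y r∤y
  ... | inj₁ (divides x' refl) =
    subst (r * r ^ k ∣_) (*-comm r x') (*-monoʳ-∣ r (prime^∣*⇒∣ pr r∤y k x' rᵏ∣x'y))
    where
    instance _ = prime⇒nonZero pr
    regroup : x' * r * y ≡ r * (x' * y)
    regroup = trans (cong (_* y) (*-comm x' r)) (*-assoc r x' y)
    rᵏ∣x'y : r ^ k ∣ x' * y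
    rᵏ∣x'y = *-cancelˡ-∣ r (subst (r * r ^ k ∣_) regroup rʳᵏ∣xy)

  peel : ∀ {r} x y k {R} → Prime r → ¬ r ∣ y → x * y ≡ r ^ k * R →
         ∃[ x' ] x ≡ r ^ k * x' × x' * y ≡ R
  peel {r} x y k {R} pr r∤y xy≡rᵏR
    with prime^∣*⇒∣ pr r∤y k x (divides R (trans xy≡rᵏR (*-comm (r ^ k) R)))
  ... | divides x' refl = x' , *-comm x' (r ^ k) , *-cancelˡ-≡ (x' * y) R (r ^ k) regrouped
    where
    instance _ = m^n≢0 r k {{prime⇒nonZero pr}}
    regrouped : r ^ k * (x' * y) ≡ r ^ k * R
    regrouped = trans (sym (*-assoc (r ^ k) x' y))
                      (trans (cong (_* y) (*-comm (r ^ k) x')) xy≡rᵏR)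

  pick : Bool → ℕ → ℕ
  pick true  m = m
  pick false m = 1

  -- A partial splitting: h = P·x and h + 1 = Q·y, where the part x·y = R
  -- remains to be distributed.
  record Split (h P Q R : ℕ) : Set where
    constructor split
    field
      x y     : ℕ
      h≡Px    : h ≡ P * x
      h+1≡Qy  : suc h ≡ Q * y
      xy≡R    : x * y ≡ R

  -- A prime power rᵏ in the undistributed part goes entirely to h or to h + 1,
  -- because r cannot divide both.
  assign : ∀ {r h P Q R} → Prime r → ∀ k → Split h P Q (r ^ k * R) →
           ∃[ b ] Split h (P * pick b (r ^ k)) (Q * pick (not b) (r ^ k)) R
  assign {r} {h} {P} {Q} pr k (split x y h≡Px h+1≡Qy xy≡rᵏR) with r ∣? y
  ... | no r∤y with peel x y k pr r∤y xy≡rᵏR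
  ...   | x' , refl , x'y≡R =
    true , split x' y (trans h≡Px (sym (*-assoc P (r ^ k) x')))
                      (trans h+1≡Qy (cong (_* y) (sym (*-identityʳ Q)))) x'y≡R
  assign {r} {h} {P} {Q} pr k (split x y h≡Px h+1≡Qy xy≡rᵏR) | yes r∣y
    with peel y x k pr r∤x (trans (*-comm y x) xy≡rᵏR)
    where
    r∤x : ¬ r ∣ x
    r∤x r∣x = ∤-consecutive pr (subst (r ∣_) (sym h≡Px) (∣-trans r∣x (n∣m*n P)))
                              (subst (r ∣_) (sym h+1≡Qy) (∣-trans r∣y (n∣m*n Q)))
  ... | y' , refl , y'x≡R =
    false , split x y' (trans h≡Px (cong (_* x) (sym (*-identityʳ P))))
                       (trans h+1≡Qy (sym (*-assoc Q (r ^ k) y')))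
                       (trans (*-comm x y') y'x≡R)

  finish : ∀ {h P Q} → Split h P Q 1 → h ≡ P × suc h ≡ Q
  finish {P = P} {Q} (split x y h≡Px h+1≡Qy xy≡1) =
    trans h≡Px (trans (cong (P *_) (m*n≡1⇒m≡1 x y xy≡1)) (*-identityʳ P)) ,
    trans h+1≡Qy (trans (cong (Q *_) (m*n≡1⇒n≡1 x y xy≡1)) (*-identityʳ Q))

  assigned : Bool → Bool → Bool → ℕ → ℕ → ℕ → ℕ
  assigned a b c A B C = 1 * pick a A * pick b B * pick c C

  distribute : ∀ {r s t h} → Prime r → Prime s → Prime t → ∀ i j k →
               h * suc h ≡ r ^ i * (s ^ j * (t ^ k * 1)) →
               ∃[ a ] ∃[ b ] ∃[ c ] h ≡ assigned a b c (r ^ i) (s ^ j) (t ^ k)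
                                  × suc h ≡ assigned (not a) (not b) (not c) (r ^ i) (s ^ j) (t ^ k)
  distribute {r} {s} {t} {h} pr ps pt i j k h[h+1]≡ with assign pr i start
    where
    start : Split h 1 1 (r ^ i * (s ^ j * (t ^ k * 1)))
    start = split h (suc h) (sym (*-identityˡ h)) (sym (*-identityˡ (suc h))) h[h+1]≡
  ... | a , split₁ with assign ps j split₁
  ... | b , split₂ with assign pt k split₂
  ... | c , split₃ = a , b , c , finish split₃

  pick-cong-mod : ∀ {m m' n} .{{_ : NonZero n}} b → m ≡ m' mod n → pick b m ≡ pick b m' mod n
  pick-cong-mod true  m≡m' = m≡m'
  pick-cong-mod false _    = mod-refl

  assigned-cong-mod : ∀ {A A' B B' C C' n} .{{_ : NonZero n}} a b c →
                      A ≡ A' mod n → B ≡ B' mod n → C ≡ C' mod n →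
                      assigned a b c A B C ≡ assigned a b c A' B' C' mod n
  assigned-cong-mod a b c A≡ B≡ C≡ =
    *-cong-mod (*-cong-mod (*-cong-mod (mod-refl {a = 1}) (pick-cong-mod a A≡)) (pick-cong-mod b B≡))
               (pick-cong-mod c C≡)

  consecutive-residues : ∀ a b c →
    suc (assigned a b c 0 13 1) ≡ assigned (not a) (not b) (not c) 0 13 1 mod 16 →
    a ≡ true × b ≡ true
  consecutive-residues true  true  c     _                = refl , refl
  consecutive-residues true  false true  (≡-remainders ())
  consecutive-residues true  false false (≡-remainders ())
  consecutive-residues false true  true  (≡-remainders ())
  consecutive-residues false true  false (≡-remainders ())
  consecutive-residues false false true  (≡-remainders ())
  consecutive-residues false false false (≡-remainders ())

  splitting-residues : ∀ {h A B C} a b c → A ≡ 0 mod 16 → B ≡ 13 mod 16 → C ≡ 1 mod 16 →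
                       h ≡ assigned a b c A B C →
                       suc h ≡ assigned (not a) (not b) (not c) A B C →
                       a ≡ true × b ≡ true
  splitting-residues a b c A≡0 B≡13 C≡1 h≡ h+1≡ =
    consecutive-residues a b c
      (mod-trans (suc-cong-mod (mod-sym (assigned-cong-mod a b c A≡0 B≡13 C≡1)))
      (mod-trans (≡⇒≡mod (trans (cong suc (sym h≡)) h+1≡))
                 (assigned-cong-mod (not a) (not b) (not c) A≡0 B≡13 C≡1)))

  consecutive-split : ∀ {r s t h} → Prime r → Prime s → Prime t → ∀ i j k →
                      r ^ i ≡ 0 mod 16 → s ^ j ≡ 13 mod 16 → t ^ k ≡ 1 mod 16 →
                      h * suc h ≡ r ^ i * (s ^ j * (t ^ k * 1)) →
                      h ≡ r ^ i * s ^ j × suc h ≡ t ^ k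
  consecutive-split {r} {s} {t} {h} pr ps pt i j k A≡0 B≡13 C≡1 h[h+1]≡
    with distribute {h = h} pr ps pt i j k h[h+1]≡
  ... | a , b , c , h≡ , h+1≡ with splitting-residues a b c A≡0 B≡13 C≡1 h≡ h+1≡
  ... | refl , refl = last-splitting c h≡ h+1≡
    where
    A = r ^ i
    B = s ^ j
    C = t ^ k
    -- Of the two remaining splittings, h + 1 = 1 contradicts h = ABC ≠ 0.
    last-splitting : ∀ c → h ≡ assigned true true c A B C →
                     suc h ≡ assigned false false (not c) A B C → h ≡ A * B × suc h ≡ C
    last-splitting true h≡ h+1≡1 =
      contradiction (trans (sym h≡) (suc-injective h+1≡1)) (≢-nonZero⁻¹ (1 * A * B * C) {{ABC≢0}})
      where
      instance
        _ = m^n≢0 r i {{prime⇒nonZero pr}}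
        _ = m^n≢0 s j {{prime⇒nonZero ps}}
        _ = m^n≢0 t k {{prime⇒nonZero pt}}
      ABC≢0 : NonZero (1 * A * B * C)
      ABC≢0 = m*n≢0 (1 * A * B) C {{m*n≢0 (1 * A) B {{m*n≢0 1 A}}}}
    last-splitting false h≡ h+1≡ =
      trans h≡ (trans (*-identityʳ (1 * A * B)) (cong (_* B) (*-identityˡ A))) ,
      trans h+1≡ (*-identityˡ C)

  2^[4+4α]≡0[16] : ∀ α → 2 ^ (suc α * 4) ≡ 0 mod 16
  2^[4+4α]≡0[16] α = ≡-remainders (n∣m⇒m%n≡0 _ 16
    (subst (16 ∣_) (sym (^-distribˡ-+-* 2 4 (α * 4))) (m∣m*n (2 ^ (α * 4)))))

  5^[3+4j]≡13[16] : ∀ j → 5 ^ (3 + j * 4) ≡ 13 mod 16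
  5^[3+4j]≡13[16] j =
    mod-trans (≡⇒≡mod (trans (^-distribˡ-+-* 5 3 (j * 4)) (cong (125 *_) 5^[4j]≡625^j)))
    (mod-trans (*-cong-mod (mod-refl {a = 125}) (^-cong-mod 625≡1 j))
               (≡-remainders (cong (λ e → (125 * e) % 16) (^-zeroˡ j))))
    where
    625≡1 : 625 ≡ 1 mod 16
    625≡1 = ≡-remainders refl
    5^[4j]≡625^j : 5 ^ (j * 4) ≡ 625 ^ j
    5^[4j]≡625^j = trans (cong (5 ^_) (*-comm j 4)) (sym (^-*-assoc 5 4 j))

  odd-prime^[4γ]≡1[16] : ∀ {p} → Prime p → p ≢ 2 → ∀ γ → p ^ (γ * 4) ≡ 1 mod 16
  odd-prime^[4γ]≡1[16] {p} pP p≢2 γ =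
    mod-trans (≡⇒≡mod (sym (^-*-assoc p γ 4)))
              (odd⁴≡1[16] (p ^ γ) (mod-trans (^-cong-mod p-odd γ) (≡⇒≡mod (^-zeroˡ γ))))
    where
    p-odd : p ≡ 1 mod 2
    p-odd with p % 2 in p%2≡ | m%n<n p 2
    ... | 0 | _ = contradiction (sym (prime∣prime⇒≡ prime[2] pP (m%n≡0⇒n∣m p 2 p%2≡))) p≢2
    ... | 1 | _ = ≡-remainders p%2≡
    ... | 2+ _ | s≤s (s≤s ())

  81^γ≡1[125]⇒γ%25≡0 : ∀ γ → 81 ^ γ ≡ 1 mod 125 → γ % 25 ≡ 0
  81^γ≡1[125]⇒γ%25≡0 γ 81^γ≡1 =
    table (m%n<n γ 25) (remainders (mod-trans (mod-sym (^-period {b = 81} 25 81²⁵≡1 γ)) 81^γ≡1))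
    where
    81²⁵≡1 : 81 ^ 25 ≡ 1 mod 125
    81²⁵≡1 = ≡-remainders refl
    table : ∀ {r} → r < 25 → 81 ^ r % 125 ≡ 1 → r ≡ 0
    table = from-yes (allUpTo? (λ r → (81 ^ r % 125 ≟ 1) →-dec (r ≟ 0)) 25)

  no-prime-power-successor : ∀ {p} → Prime p → ∀ a j γ →
                             suc (2 ^ a * 5 ^ (3 + j * 4)) ≢ p ^ (γ * 4)
  no-prime-power-successor {p} pP a j γ X+1≡ with p ≟ 3
  ... | no p≢3 = 3∤X (suc≡⇒∣ 3 (trans X+1≡ (sym (^-*-assoc p γ 4))) (remainders (fourth-power[3] (p ^ γ) 3∤pᵞ)))
    where
    3∤X : ¬ 3 ∣ 2 ^ a * 5 ^ (3 + j * 4)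
    3∤X = ∤-powers prime[3] (from-no (3 ∣? 2)) (from-no (3 ∣? 5)) a (3 + j * 4)
    3∤pᵞ : ¬ 3 ∣ p ^ γ
    3∤pᵞ 3∣pᵞ = p≢3 (sym (prime∣prime⇒≡ prime[3] pP (prime∣^⇒∣ p γ prime[3] 3∣pᵞ)))
  ... | yes refl = 11∤X (suc≡⇒∣ 11 X+1≡81^γ (remainders 81^γ≡1[11]))
    where
    X = 2 ^ a * 5 ^ (3 + j * 4)
    11∤X : ¬ 11 ∣ X
    11∤X = ∤-powers prime[11] (from-no (11 ∣? 2)) (from-no (11 ∣? 5)) a (3 + j * 4)
    X+1≡81^γ : suc X ≡ 81 ^ γ
    X+1≡81^γ = trans X+1≡ (trans (cong (3 ^_) (*-comm γ 4)) (sym (^-*-assoc 3 4 γ)))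
    125∣X : 125 ∣ X
    125∣X = ∣-trans (subst (125 ∣_) (sym (^-distribˡ-+-* 5 3 (j * 4))) (m∣m*n (5 ^ (j * 4))))
                    (n∣m*n (2 ^ a))
    81^γ≡1[125] : 81 ^ γ ≡ 1 mod 125
    81^γ≡1[125] = ≡-remainders (trans (cong (_% 125) (sym X+1≡81^γ)) (%-remove-+ʳ 1 125∣X))
    81²⁵≡1 : 81 ^ 25 ≡ 1 mod 11
    81²⁵≡1 = ≡-remainders refl
    -- 25 ∣ γ, and 81²⁵ ≡ 1 modulo 11
    81^γ≡1[11] : 81 ^ γ ≡ 1 mod 11
    81^γ≡1[11] = mod-trans (^-period {b = 81} 25 81²⁵≡1 γ)
                           (≡⇒≡mod (cong (81 ^_) (81^γ≡1[125]⇒γ%25≡0 γ 81^γ≡1[125])))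

  -- The case β ≥ 2, after cancelling 5⁵; here 4β − 5 = 3 + 4j.
  no-consecutive-product : ∀ {p} → Prime p → p ≢ 2 → ∀ α j γ h →
    h * suc h ≢ 2 ^ (suc α * 4) * (5 ^ (3 + j * 4) * (p ^ (γ * 4) * 1))
  no-consecutive-product {p} pP p≢2 α j γ h h[h+1]≡ =
    let h≡AB , h+1≡C = consecutive-split {h = h} prime[2] prime[5] pP (suc α * 4) (3 + j * 4) (γ * 4)
                         (2^[4+4α]≡0[16] α) (5^[3+4j]≡13[16] j) (odd-prime^[4γ]≡1[16] pP p≢2 γ)
                         h[h+1]≡
    in no-prime-power-successor pP (suc α * 4) j γ (trans (cong suc (sym h≡AB)) h+1≡C)

  5∤2ᵃpᶜ : ∀ {p} → Prime p → p ≢ 5 → ∀ a c → ¬ 5 ∣ 2 ^ a * p ^ c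
  5∤2ᵃpᶜ pP p≢5 = ∤-powers prime[5] (from-no (5 ∣? 2)) (λ 5∣p → p≢5 (sym (prime∣prime⇒≡ prime[5] pP 5∣p)))

  -- Comparing powers of 5: β ≤ 1 is impossible since 5⁵ ∤ 2^(4α) 5^(4β) p^(4γ).
  no-product-solution : ∀ {p} → Prime p → p ≢ 2 → p ≢ 5 → ∀ α β γ h →
    3125 * (h * suc h) ≢ 2 ^ (suc α * 4) * 5 ^ (β * 4) * p ^ (γ * 4)
  no-product-solution {p} pP p≢2 p≢5 α zero γ h eq =
    5∤2ᵃpᶜ pP p≢5 (suc α * 4) (γ * 4) (divides (625 * (h * suc h)) (trans (cong (_* C) (sym (*-identityʳ A)))
                                            (trans (sym eq) (regroup (h * suc h)))))
    where
    A = 2 ^ (suc α * 4)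
    C = p ^ (γ * 4)
    regroup : ∀ H → 3125 * H ≡ 625 * H * 5
    regroup = solve-∀
  no-product-solution {p} pP p≢2 p≢5 α (suc zero) γ h eq =
    5∤2ᵃpᶜ pP p≢5 (suc α * 4) (γ * 4) (divides (h * suc h) (trans (sym 5H≡AC) (*-comm 5 (h * suc h))))
    where
    A = 2 ^ (suc α * 4)
    C = p ^ (γ * 4)
    regroupˡ : ∀ H → 3125 * H ≡ 625 * (5 * H)
    regroupˡ = solve-∀
    regroupʳ : ∀ A C → A * 625 * C ≡ 625 * (A * C)
    regroupʳ = solve-∀
    5H≡AC : 5 * (h * suc h) ≡ A * C
    5H≡AC = *-cancelˡ-≡ _ _ 625 (trans (sym (regroupˡ (h * suc h))) (trans eq (regroupʳ A C)))
  no-product-solution {p} pP p≢2 p≢5 α (suc (suc j)) γ h eq =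
    no-consecutive-product pP p≢2 α j γ h (*-cancelˡ-≡ _ _ 3125 (begin
      3125 * (h * suc h)                  ≡⟨ eq ⟩
      -- (2 + j) * 4 unfolds to 5 + (3 + j * 4)
      A * 5 ^ (5 + (3 + j * 4)) * C       ≡⟨ cong (λ e → A * e * C) (^-distribˡ-+-* 5 5 (3 + j * 4)) ⟩
      A * (3125 * B) * C                  ≡⟨ regroup A B C ⟩
      3125 * (A * (B * (C * 1)))          ∎))
    where
    open ≡-Reasoning
    A = 2 ^ (suc α * 4)
    B = 5 ^ (3 + j * 4)
    C = p ^ (γ * 4)
    regroup : ∀ A B C → A * (3125 * B) * C ≡ 3125 * (A * (B * (C * 1)))
    regroup = solve-∀

  even-or-odd : ∀ w → (∃[ h ] w ≡ h * 2) ⊎ (∃[ h ] w ≡ suc (h * 2))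
  even-or-odd zero = inj₁ (0 , refl)
  even-or-odd (suc w) with even-or-odd w
  ... | inj₁ (h , refl) = inj₂ (h , refl)
  ... | inj₂ (h , refl) = inj₁ (suc h , refl)

  odd-root : ∀ w M → 3125 * (w * w) ≡ 4 * M + 3125 → ∃[ h ] 3125 * (h * suc h) ≡ M
  odd-root w M eq with even-or-odd w
  ... | inj₁ (h , refl) = contradiction even≡odd (even≢odd (6250 * (h * h)) (2 * M + 1562))
    where
    even≡odd : 2 * (6250 * (h * h)) ≡ suc (2 * (2 * M + 1562))
    even≡odd = trans (lhs h) (trans eq (rhs M))
      where
      lhs : ∀ h → 2 * (6250 * (h * h)) ≡ 3125 * (h * 2 * (h * 2))
      lhs = solve-∀
      rhs : ∀ M → 4 * M + 3125 ≡ suc (2 * (2 * M + 1562))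
      rhs = solve-∀
  ... | inj₂ (h , refl) = h , *-cancelˡ-≡ _ _ 4 (+-cancelʳ-≡ 3125 _ _ (trans (square h) eq))
    where
    square : ∀ h → 4 * (3125 * (h * suc h)) + 3125 ≡ 3125 * (suc (h * 2) * suc (h * 2))
    square = solve-∀

  no-square : ∀ {p} → Prime p → p ≢ 2 → p ≢ 5 → ∀ α β γ → α ≥ 1 → ∀ w →
              3125 * (w * w) ≢ 4 * (2 ^ α * 5 ^ β * p ^ γ) ^ 4 + 3125
  no-square {p} pP p≢2 p≢5 (suc α) β γ _ w eq
    with odd-root w _ eq
  ... | h , 3125h[h+1]≡N⁴ = no-product-solution pP p≢2 p≢5 α β γ h (trans 3125h[h+1]≡N⁴ N⁴≡)
    where
    N⁴≡ : (2 ^ suc α * 5 ^ β * p ^ γ) ^ 4 ≡ 2 ^ (suc α * 4) * 5 ^ (β * 4) * p ^ (γ * 4)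
    N⁴≡ = trans (^-distribʳ-* (2 ^ suc α * 5 ^ β) (p ^ γ) 4)
           (cong₂ _*_ (trans (^-distribʳ-* (2 ^ suc α) (5 ^ β) 4)
                             (cong₂ _*_ (^-*-assoc 2 (suc α) 4) (^-*-assoc 5 β 4)))
                      (^-*-assoc p γ 4))

open import Defs
open import Data.Nat.Base using (ℕ; _≥_)
open import Data.Nat.Primality using (Prime)
open import Data.Integer.Base using (ℤ; +_; _+_; _-_; _*_; _^_)
open import Data.Integer.Divisibility using (_∣_)
open import Data.Integer.Coprimality using (Coprime)
open import Relation.Binary.PropositionalEquality using (_≡_; _≢_)

open import Data.Integer.Base using (∣_∣)
import Data.Nat.Base as ℕ
import Data.Integer.Properties as ℤ
open import Data.Integer.Tactic.RingSolver using (solve-∀)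
open import Relation.Binary.PropositionalEquality using (refl; sym; trans; cong; cong₂; module ≡-Reasoning)

-- The ring solver does not see through _^_, so the identity is stated with
-- each power written as its definitional unfolding (x ^ 2 = x * (x * + 1), …).
identity-unfolded : ∀ u v →
  + 3125 * ((u * (u * + 1) - v * (v * + 1)) * (u * (u * + 1) - v * (v * + 1)))
    ≡ + 4 * ((v * + 5) * ((v * + 5) * ((v * + 5) * ((v * + 5) * + 1))))
      + + 625 * (v * (v * (v * (v * + 1))) - + 10 * (u * (u * + 1)) * (v * (v * + 1))
                 + + 5 * (u * (u * (u * (u * + 1)))))
identity-unfolded = solve-∀

u²-v²-identity : ∀ u v →
  + 3125 * ((u ^ 2 - v ^ 2) * (u ^ 2 - v ^ 2))
    ≡ + 4 * (v * + 5) ^ 4 + + 625 * (v ^ 4 - + 10 * u ^ 2 * v ^ 2 + + 5 * u ^ 4)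
u²-v²-identity = identity-unfolded

pos-^ : ∀ a k → + (a ℕ.^ k) ≡ (+ a) ^ k
pos-^ a ℕ.zero    = refl
pos-^ a (ℕ.suc k) = trans (ℤ.pos-* a (a ℕ.^ k)) (cong (+ a *_) (pos-^ a k))

natural-equation : ∀ u v N → v * + 5 ≡ + N → v ^ 4 - + 10 * u ^ 2 * v ^ 2 + + 5 * u ^ 4 ≡ + 5 →
                   3125 ℕ.* (∣ u ^ 2 - v ^ 2 ∣ ℕ.* ∣ u ^ 2 - v ^ 2 ∣) ≡ 4 ℕ.* N ℕ.^ 4 ℕ.+ 3125
natural-equation u v N 5v≡N Q≡5 = begin
  3125 ℕ.* (∣ w ∣ ℕ.* ∣ w ∣)           ≡⟨ cong (3125 ℕ.*_) (ℤ.abs-* w w) ⟨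
  3125 ℕ.* ∣ w * w ∣                  ≡⟨ ℤ.abs-* (+ 3125) (w * w) ⟨
  ∣ + 3125 * (w * w) ∣                ≡⟨ cong ∣_∣ (u²-v²-identity u v) ⟩
  ∣ + 4 * (v * + 5) ^ 4 + + 625 * (v ^ 4 - + 10 * u ^ 2 * v ^ 2 + + 5 * u ^ 4) ∣
                                      ≡⟨ cong₂ (λ x y → ∣ + 4 * x ^ 4 + + 625 * y ∣) 5v≡N Q≡5 ⟩
  ∣ + 4 * (+ N) ^ 4 + + 3125 ∣         ≡⟨ cong (λ x → ∣ + 4 * x + + 3125 ∣) (pos-^ N 4) ⟨
  ∣ + 4 * + (N ℕ.^ 4) + + 3125 ∣       ≡⟨ cong (λ x → ∣ x + + 3125 ∣) (ℤ.pos-* 4 (N ℕ.^ 4)) ⟨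
  ∣ + (4 ℕ.* N ℕ.^ 4) + + 3125 ∣       ≡⟨ cong ∣_∣ (ℤ.pos-+ (4 ℕ.* N ℕ.^ 4) 3125) ⟨
  4 ℕ.* N ℕ.^ 4 ℕ.+ 3125               ∎
  where
  open ≡-Reasoning
  w = u ^ 2 - v ^ 2

lemma2p1 : (p : ℕ) → Prime p → p ≢ 2 → p ≢ 5 →
           (α β γ : ℕ) → α ≥ 1 →
           (u v : ℤ) → Coprime u v → (+ 2) ∣ v →
           (+ 2) ^ α * (+ 5) ^ β * (+ p) ^ γ
             ≡ v * (v ^ 4 - (+ 10) * u ^ 2 * v ^ 2 + (+ 5) * u ^ 4) →
           v ^ 4 - (+ 10) * u ^ 2 * v ^ 2 + (+ 5) * u ^ 4 ≢ + 5
lemma2p1 p pP p≢2 p≢5 α β γ α≥1 u v _ _ N≡vQ Q≡5 =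
  Natural.no-square pP p≢2 p≢5 α β γ α≥1 ∣ u ^ 2 - v ^ 2 ∣ (natural-equation u v N 5v≡N Q≡5)
  where
  open ≡-Reasoning
  N = 2 ℕ.^ α ℕ.* 5 ℕ.^ β ℕ.* p ℕ.^ γ
  5v≡N : v * + 5 ≡ + N
  5v≡N = begin
    v * + 5                                             ≡⟨ cong (v *_) Q≡5 ⟨
    v * (v ^ 4 - + 10 * u ^ 2 * v ^ 2 + + 5 * u ^ 4)    ≡⟨ N≡vQ ⟨
    (+ 2) ^ α * (+ 5) ^ β * (+ p) ^ γ                   ≡⟨ cong₂ (λ x y → x * y * (+ p) ^ γ) (pos-^ 2 α) (pos-^ 5 β) ⟨
    + (2 ℕ.^ α) * + (5 ℕ.^ β) * (+ p) ^ γ               ≡⟨ cong₂ _*_ (ℤ.pos-* (2 ℕ.^ α) (5 ℕ.^ β)) (pos-^ p γ) ⟨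
    + (2 ℕ.^ α ℕ.* 5 ℕ.^ β) * + (p ℕ.^ γ)               ≡⟨ ℤ.pos-* (2 ℕ.^ α ℕ.* 5 ℕ.^ β) (p ℕ.^ γ) ⟨
    + N                                                 ∎
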